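{- (Split Lemma.) Let $r$ and $c$ be integer sequences of length $m$ and $n$, respectively, and let $M$ be their merge matrix. Let $i$ be an index with $r(i)=\min(r)$ and $j$ an index with $c(j)=\min(c)$. Let $M_1=M[1..i,1..j]$ and $M_2=M[i..m,j..n]$, and for each $h\in[2]$ let $p_h$ be a path in $M_h$ that dominates every path in $M_h$. Then the concatenation $p_1\circ p_2$ is a path in $M$ that dominates every path in $M$.
   Context: The merge matrix of $r$ and $c$ is the $m\times n$ matrix with $M[i,j]=r(i)+c(j)$; $M[a..b,c..d]$ is the submatrix on rows $a,\ldots,b$ and columns $c,\ldots,d$ (re-indexed from $(1,1)$ when considering paths in it, but entries/indices identified with those of $M$ when concatenating). A path in a $m'\times n'$ matrix is a sequence of indices $p(1),\ldots,p(L)$ with $p(1)=(1,1)$, $p(L)=(m',n')$, and if $p(h)=(i,j)$ then $p(h+1)\in\{(i+1,j),(i,j+1),(i+1,j+1)\}$; $M[p]=M[p(1)],\ldots,M[p(L)]$. In $p_1\circ p_2$ the common index $(i,j)$ (last of $p_1$, first of $p_2$) is as written by concatenating the two index sequences. A path $p$ dominates a path $q$ if $M[p]$ dominates $M[q]$, where for integer sequences $a$ dominates $b$ if there are extensions $a^*$ of $a$ and $b^*$ of $b$ of equal length with $a^*(k)\le b^*(k)$ for all $k$; an extension is obtained by repeating each element one or more times consecutively, preserving order. -}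

module Defs where

open import Data.Nat using (ℕ; suc)
open import Data.Integer using (ℤ; _+_; _≤_)
open import Data.Product using (_×_; _,_; ∃; ∃-syntax; Σ-syntax)
open import Data.Sum using (_⊎_)
open import Data.List using (List; []; _∷_; _++_; map; concat; zipWith; replicate; length; drop)
open import Data.List.Relation.Binary.Pointwise using (Pointwise)
open import Relation.Binary.PropositionalEquality using (_≡_)

-- Indices are 1-based pairs (row , column) of natural numbers.
Index : Set
Index = ℕ × ℕ

-- Entry of the merge matrix of r and c:  M[i,j] = r(i) + c(j).
-- Sequences are given as functions ℕ → ℤ; only positions 1..m (resp. 1..n) matter.
merge : (ℕ → ℤ) → (ℕ → ℤ) → Index → ℤ
merge r c (i , j) = r i + c j

data Step : Index → Index → Set where
  down  : ∀ {i j} → Step (i , j) (suc i , j)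
  right : ∀ {i j} → Step (i , j) (i , suc j)
  diag  : ∀ {i j} → Step (i , j) (suc i , suc j)

-- IsPath s t p : p is a path (written with absolute indices of M) from s to t,
-- i.e. a path in the submatrix M[s₁..t₁, s₂..t₂] (which starts at its (1,1)
-- and ends at its bottom-right corner).
data IsPath : Index → Index → List Index → Set where
  single : ∀ {s} → IsPath s s (s ∷ [])
  cons   : ∀ {s s' t p} → Step s s' → IsPath s' t p → IsPath s t (s ∷ p)

_∘ₚ_ : List Index → List Index → List Index
p₁ ∘ₚ p₂ = p₁ ++ drop 1 p₂

Extension : List ℤ → List ℤ → Set
Extension a a* = ∃[ ks ] (length ks ≡ length a ×
                          a* ≡ concat (zipWith (λ x k → replicate (suc k) x) a ks))

DominatesSeq : List ℤ → List ℤ → Set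
DominatesSeq a b = ∃[ a* ] ∃[ b* ] (Extension a a* × Extension b b* × Pointwise _≤_ a* b*)

entries : (ℕ → ℤ) → (ℕ → ℤ) → List Index → List ℤ
entries r c p = map (merge r c) p

Dominates : (ℕ → ℤ) → (ℕ → ℤ) → List Index → List Index → Set
Dominates r c p q = DominatesSeq (entries r c p) (entries r c q)

module Submission where

-- Clamping the indices of a path q through M by (· ⊓ i, · ⊓ j) gives a path of M₁, and by
-- (· ⊔ i, · ⊔ j) one of M₂; as r(i) and c(j) are minimal, clamping never increases an entry, so
-- p₁ and p₂ both dominate q. Dominance is read as a monotone alignment of positions. Cut q at a
-- maximal entry w: every entry of p₁ and of p₂ is at most w, so p₁ aligns to q up to w and p₂ to
-- q from w on, and the two alignments meet at the shared corner (i , j) of p₁ and p₂.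

open import Defs
open import Data.Nat using (ℕ; _≤_)
open import Data.Integer using (ℤ)
open import Data.Product using (_×_; _,_)
open import Data.List using (List)

open import Data.Nat using (zero; suc; _⊓_; _⊔_)
open import Data.Nat.Properties
  using ( ≤-refl; ≤-trans; n≤1+n; suc-injective; ⊓-sel; ⊔-sel
        ; m≤n⇒m⊓n≡m; m≥n⇒m⊓n≡n; m≤n⇒m⊔n≡n; m≥n⇒m⊔n≡m )
open import Data.Integer using () renaming (_≤_ to _≤ᶻ_)
import Data.Integer.Properties as ℤ
open import Data.List using ([]; _∷_; [_]; _++_; map; concat; zipWith; replicate; length)
open import Data.List.Properties using (map-++; ++-assoc)
open import Data.List.Extrema ℤ.≤-totalOrder using (max; argmax-sel; ⊥≤max; xs≤max)
open import Data.List.Membership.Propositional using (_∈_)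
open import Data.List.Membership.Propositional.Properties using (∈-∃++)
open import Data.List.Relation.Binary.Pointwise using (Pointwise; []; _∷_)
open import Data.List.Relation.Unary.All as All using (All; []; _∷_)
open import Data.List.Relation.Unary.Any using (here; there)
open import Data.Product using (∃-syntax; proj₁; proj₂; map₁)
import Data.Product as Product
open import Data.Sum using (_⊎_; inj₁; inj₂)
import Data.Sum as Sum
open import Function using (id)
open import Relation.Nullary using (contradiction)
open import Relation.Binary.PropositionalEquality
  using (_≡_; _≢_; refl; sym; cong; cong₂; subst)
open import Algebra.Definitions {A = ℕ} _≡_ using (Selective)

private
  variable
    x y z w : ℤ
    a a' a* b b' b* : List ℤ
    s s' t t' u : Index
    p p' q : List Index
    g h : ℕ → ℕ

-- On nonempty sequences this is DominatesSeq (see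
-- dominatesSeq⇒≼ and ≼⇒dominatesSeq), in a form whose transitivity is a simple induction.
infix 4 _≼_

data _≼_ : List ℤ → List ℤ → Set where
  end      : x ≤ᶻ y → [ x ] ≼ [ y ]
  advanceˡ : x ≤ᶻ y → a ≼ y ∷ b → x ∷ a ≼ y ∷ b
  advanceʳ : x ≤ᶻ y → x ∷ a ≼ b → x ∷ a ≼ y ∷ b
  advance  : x ≤ᶻ y → a ≼ b → x ∷ a ≼ y ∷ b

≼-head : x ∷ a ≼ y ∷ b → x ≤ᶻ y
≼-head (end h)        = h
≼-head (advanceˡ h _) = h
≼-head (advanceʳ h _) = h
≼-head (advance h _)  = h

≼-trans : a ≼ b → b ≼ a* → a ≼ a*
≼-trans {a* = _ ∷ _} (advanceˡ h α) β = advanceˡ (ℤ.≤-trans h (≼-head β)) (≼-trans α β)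
≼-trans {a = _ ∷ _} α (advanceʳ h β)  = advanceʳ (ℤ.≤-trans (≼-head α) h) (≼-trans α β)
≼-trans (end h)        (end h')        = end (ℤ.≤-trans h h')
≼-trans (advanceʳ h α) (advanceˡ h' β) = ≼-trans α β
≼-trans (advanceʳ h α) (advance h' β)  = advanceʳ (ℤ.≤-trans h h') (≼-trans α β)
≼-trans (advance h α)  (advanceˡ h' β) = advanceˡ (ℤ.≤-trans h h') (≼-trans α β)
≼-trans (advance h α)  (advance h' β)  = advance (ℤ.≤-trans h h') (≼-trans α β)
≼-trans (end _)        (advanceˡ _ ())
≼-trans (end _)        (advance _ ())
≼-trans (advanceʳ _ ()) (end _)
≼-trans (advance _ ())  (end _)

data Stretch : List ℤ → List ℤ → Set where
  []     : Stretch [] []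
  fresh  : Stretch a a* → Stretch (x ∷ a) (x ∷ a*)
  repeat : Stretch (x ∷ a) a* → Stretch (x ∷ a) (x ∷ a*)

extension⇒stretch : Extension a a* → Stretch a a*
extension⇒stretch (ks , len , refl) = stretch-expansion _ ks len
  where
  stretch-expansion : ∀ a ks → length ks ≡ length a →
                      Stretch a (concat (zipWith (λ x k → replicate (suc k) x) a ks))
  stretch-expansion []      []           _   = []
  stretch-expansion (x ∷ a) (zero  ∷ ks) len = fresh (stretch-expansion a ks (suc-injective len))
  stretch-expansion (x ∷ a) (suc k ∷ ks) len = repeat (stretch-expansion (x ∷ a) (k ∷ ks) len)

stretch⇒extension : Stretch a a* → Extension a a*
stretch⇒extension [] = [] , refl , refl
stretch⇒extension (fresh σ) with stretch⇒extension σ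
... | ks , len , refl = zero ∷ ks , cong suc len , refl
stretch⇒extension (repeat σ) with stretch⇒extension σ
... | k ∷ ks , len , refl = suc k ∷ ks , len , refl

stretches⇒≼ : Stretch (x ∷ a) a* → Stretch (y ∷ b) b* → Pointwise _≤ᶻ_ a* b* → x ∷ a ≼ y ∷ b
stretches⇒≼ (fresh [])               (fresh [])               (h ∷ []) = end h
stretches⇒≼ (fresh {a = _ ∷ _} σ)    (fresh {a = _ ∷ _} τ)    (h ∷ hs) = advance h (stretches⇒≼ σ τ hs)
stretches⇒≼ (fresh {a = _ ∷ _} σ)    (repeat τ)               (h ∷ hs) = advanceˡ h (stretches⇒≼ σ τ hs)
stretches⇒≼ (repeat σ)               (fresh {a = _ ∷ _} τ)    (h ∷ hs) = advanceʳ h (stretches⇒≼ σ τ hs)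
stretches⇒≼ (repeat σ)               (repeat τ)               (_ ∷ hs) = stretches⇒≼ σ τ hs
stretches⇒≼ (fresh [])               (fresh (fresh _))        (_ ∷ ())
stretches⇒≼ (fresh [])               (fresh (repeat _))       (_ ∷ ())
stretches⇒≼ (fresh [])               (repeat (fresh _))       (_ ∷ ())
stretches⇒≼ (fresh [])               (repeat (repeat _))      (_ ∷ ())
stretches⇒≼ (fresh (fresh _))        (fresh [])               (_ ∷ ())
stretches⇒≼ (fresh (repeat _))       (fresh [])               (_ ∷ ())
stretches⇒≼ (repeat (fresh _))       (fresh [])               (_ ∷ ())
stretches⇒≼ (repeat (repeat _))      (fresh [])               (_ ∷ ())

≼⇒stretches : a ≼ b → ∃[ a* ] ∃[ b* ] (Stretch a a* × Stretch b b* × Pointwise _≤ᶻ_ a* b*)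
≼⇒stretches (end h) = _ , _ , fresh [] , fresh [] , h ∷ []
≼⇒stretches (advanceˡ h α) with _ , _ , σ , τ , hs ← ≼⇒stretches α = _ , _ , fresh σ , repeat τ , h ∷ hs
≼⇒stretches (advanceʳ h α) with _ , _ , σ , τ , hs ← ≼⇒stretches α = _ , _ , repeat σ , fresh τ , h ∷ hs
≼⇒stretches (advance h α)  with _ , _ , σ , τ , hs ← ≼⇒stretches α = _ , _ , fresh σ , fresh τ , h ∷ hs

dominatesSeq⇒≼ : DominatesSeq (x ∷ a) (y ∷ b) → x ∷ a ≼ y ∷ b
dominatesSeq⇒≼ (_ , _ , ea , eb , hs) = stretches⇒≼ (extension⇒stretch ea) (extension⇒stretch eb) hs

≼⇒dominatesSeq : a ≼ b → DominatesSeq a b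
≼⇒dominatesSeq α with _ , _ , σ , τ , hs ← ≼⇒stretches α =
  _ , _ , stretch⇒extension σ , stretch⇒extension τ , hs

data Last {A : Set} : List A → A → Set where
  here  : ∀ {v} → Last [ v ] v
  there : ∀ {v v' vs} → Last vs v → Last (v' ∷ vs) v

Last-∷ʳ : ∀ {A : Set} (vs : List A) v → Last (vs ++ [ v ]) v
Last-∷ʳ []       v = here
Last-∷ʳ (_ ∷ vs) v = there (Last-∷ʳ vs v)

≼-++ : Last a x → Last b y → a ≼ b → x ∷ a' ≼ y ∷ b' → a ++ a' ≼ b ++ b'
≼-++ here       here       (end _)        γ = γ
≼-++ (there ℓ)  ℓ'         (advanceˡ h α) γ = advanceˡ h (≼-++ ℓ ℓ' α γ)
≼-++ ℓ          (there ℓ') (advanceʳ h α) γ = advanceʳ h (≼-++ ℓ ℓ' α γ)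
≼-++ (there ℓ)  (there ℓ') (advance h α)  γ = advance h (≼-++ ℓ ℓ' α γ)
≼-++ here       (there ())  (end _)       _
≼-++ (there ()) _           (end _)       _
≼-++ here       _           (advanceˡ _ ()) _
≼-++ _          here        (advanceʳ _ ()) _
≼-++ here       _           (advance _ ())  _
≼-++ (there _)  here        (advance _ ())  _

≼-All-≤ : a ≼ b → All (_≤ᶻ w) b → All (_≤ᶻ w) a
≼-All-≤ (end h)        (hw ∷ [])      = ℤ.≤-trans h hw ∷ []
≼-All-≤ (advanceˡ h α) hws@(hw ∷ _)  = ℤ.≤-trans h hw ∷ ≼-All-≤ α hws
≼-All-≤ (advanceʳ h α) (_ ∷ hws)      = ≼-All-≤ α hws
≼-All-≤ (advance h α)  (hw ∷ hws)     = ℤ.≤-trans h hw ∷ ≼-All-≤ α hws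

All-≤⇒≼ : All (_≤ᶻ w) (x ∷ a) → x ∷ a ≼ [ w ]
All-≤⇒≼ {a = []}    (h ∷ [])  = end h
All-≤⇒≼ {a = _ ∷ _} (h ∷ hws) = advanceˡ h (All-≤⇒≼ hws)

≼-prefix : ∀ B₁ {B₂} → a ≼ B₁ ++ w ∷ B₂ → All (_≤ᶻ w) a → a ≼ B₁ ++ [ w ]
≼-prefix {a = _ ∷ _} []   _              hws       = All-≤⇒≼ hws
-- The second clause is an instance of the fourth; placed first, it makes Agda split B₁ before
-- the alignment, which rules out the case [ x ] ≼ [ y ].
≼-prefix (_ ∷ B₁@[])      (advanceʳ h α) hws       = advanceʳ h (≼-prefix B₁ α hws)
≼-prefix B₁@(_ ∷ _)       (advanceˡ h α) (_ ∷ hws) = advanceˡ h (≼-prefix B₁ α hws)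
≼-prefix (_ ∷ B₁)         (advanceʳ h α) hws       = advanceʳ h (≼-prefix B₁ α hws)
≼-prefix (_ ∷ B₁)         (advance h α)  (_ ∷ hws) = advance h (≼-prefix B₁ α hws)

≼-suffix : ∀ B₁ {B₂} → a ≼ B₁ ++ w ∷ B₂ → All (_≤ᶻ w) a → a ≼ w ∷ B₂
≼-suffix []          α              _          = α
-- The second clause plays the same role as in ≼-prefix.
≼-suffix (_ ∷ B₁@[]) (advanceʳ h α) hws        = ≼-suffix B₁ α hws
≼-suffix B₁@(_ ∷ _)  (advanceˡ h α) (hw ∷ hws) = advanceˡ hw (≼-suffix B₁ α hws)
≼-suffix (_ ∷ B₁)    (advanceʳ h α) hws        = ≼-suffix B₁ α hws
≼-suffix (_ ∷ B₁)    (advance h α)  (hw ∷ hws) = advanceˡ hw (≼-suffix B₁ α hws)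

≼⇒≢[] : a ≼ b → b ≢ []
≼⇒≢[] (end _)        ()
≼⇒≢[] (advanceˡ _ _) ()
≼⇒≢[] (advanceʳ _ _) ()
≼⇒≢[] (advance _ _)  ()

maximum : b ≢ [] → ∃[ w ] (w ∈ b × All (_≤ᶻ w) b)
maximum {b = []}    b≢[] = contradiction refl b≢[]
maximum {b = y ∷ b} _ with argmax-sel id y b
... | inj₁ max≡y = max y b , here max≡y , ⊥≤max y b ∷ xs≤max y b
... | inj₂ max∈b = max y b , there max∈b , ⊥≤max y b ∷ xs≤max y b

≼-glue : Last a z → a ≼ b → z ∷ a' ≼ b → a ++ a' ≼ b
≼-glue ℓ α β with w , w∈b , hws ← maximum (≼⇒≢[] α) with B₁ , B₂ , refl ← ∈-∃++ w∈b =
  subst (_ ≼_) (++-assoc B₁ [ w ] B₂)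
    (≼-++ ℓ (Last-∷ʳ B₁ w) (≼-prefix B₁ α (≼-All-≤ α hws)) (≼-suffix B₁ β (≼-All-≤ β hws)))

_≤²_ : Index → Index → Set
s ≤² t = proj₁ s ≤ proj₁ t × proj₂ s ≤ proj₂ t

≤²-refl : s ≤² s
≤²-refl = ≤-refl , ≤-refl

≤²-trans : s ≤² s' → s' ≤² t → s ≤² t
≤²-trans (h₁ , h₂) (h₁' , h₂') = ≤-trans h₁ h₁' , ≤-trans h₂ h₂'

Step⇒≤² : Step s s' → s ≤² s'
Step⇒≤² down  = n≤1+n _ , ≤-refl
Step⇒≤² right = ≤-refl , n≤1+n _
Step⇒≤² diag  = n≤1+n _ , n≤1+n _

IsPath⇒≤² : IsPath s t p → s ≤² t
IsPath⇒≤² single      = ≤²-refl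
IsPath⇒≤² (cons st π) = ≤²-trans (Step⇒≤² st) (IsPath⇒≤² π)

IsPath⇒within : IsPath s t p → All (λ e → s ≤² e × e ≤² t) p
IsPath⇒within single      = (≤²-refl , ≤²-refl) ∷ []
IsPath⇒within (cons st π) =
  (≤²-refl , ≤²-trans (Step⇒≤² st) (IsPath⇒≤² π))
  ∷ All.map (map₁ (≤²-trans (Step⇒≤² st))) (IsPath⇒within π)

IsPath-head : IsPath s t p → ∃[ p' ] p ≡ s ∷ p'
IsPath-head single     = _ , refl
IsPath-head (cons _ _) = _ , refl

IsPath-last : (f : Index → ℤ) → IsPath s t p → Last (map f p) (f t)
IsPath-last f single     = here
IsPath-last f (cons _ π) = there (IsPath-last f π)

IsPath-∘ₚ : IsPath s t p → IsPath t u q → IsPath s u (p ∘ₚ q)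
IsPath-∘ₚ single      single      = single
IsPath-∘ₚ single      (cons st π) = cons st π
IsPath-∘ₚ (cons st π) ρ           = cons st (IsPath-∘ₚ π ρ)

UnitSteps : (ℕ → ℕ) → Set
UnitSteps g = ∀ k → g (suc k) ≡ g k ⊎ g (suc k) ≡ suc (g k)

⊓-unitSteps : ∀ i → UnitSteps (_⊓ i)
⊓-unitSteps zero    zero    = inj₁ refl
⊓-unitSteps zero    (suc k) = inj₁ refl
⊓-unitSteps (suc i) zero    = inj₂ refl
⊓-unitSteps (suc i) (suc k) = Sum.map (cong suc) (cong suc) (⊓-unitSteps i k)

⊔-unitSteps : ∀ i → UnitSteps (_⊔ i)
⊔-unitSteps zero    zero    = inj₂ refl
⊔-unitSteps zero    (suc k) = inj₂ refl
⊔-unitSteps (suc i) zero    = inj₁ refl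
⊔-unitSteps (suc i) (suc k) = Sum.map (cong suc) (cong suc) (⊔-unitSteps i k)

Step-image : UnitSteps g → UnitSteps h → Step s s' →
             Step (Product.map g h s) (Product.map g h s') ⊎ Product.map g h s ≡ Product.map g h s'
Step-image {g} {h} g-steps h-steps (down {i} {j}) with g-steps i
... | inj₁ eq = inj₂ (cong (_, h j) (sym eq))
... | inj₂ eq rewrite eq = inj₁ down
Step-image {g} {h} g-steps h-steps (right {i} {j}) with h-steps j
... | inj₁ eq = inj₂ (cong (g i ,_) (sym eq))
... | inj₂ eq rewrite eq = inj₁ right
Step-image g-steps h-steps (diag {i} {j}) with g-steps i | h-steps j
... | inj₁ eq | inj₁ eq' rewrite eq | eq' = inj₂ refl
... | inj₁ eq | inj₂ eq' rewrite eq | eq' = inj₁ right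
... | inj₂ eq | inj₁ eq' rewrite eq | eq' = inj₁ down
... | inj₂ eq | inj₂ eq' rewrite eq | eq' = inj₁ diag

module _ (r c : ℕ → ℤ) where

  private
    M[_] : List Index → List ℤ
    M[_] = entries r c

  ≼-stay : IsPath s t q → merge r c s ≤ᶻ y → M[ q ] ≼ b → M[ q ] ≼ y ∷ b
  ≼-stay single     = advanceʳ
  ≼-stay (cons _ _) = advanceʳ

  dominates⇒≼ : IsPath s t p → IsPath s' t' q → Dominates r c p q → M[ p ] ≼ M[ q ]
  dominates⇒≼ π ρ with _ , refl ← IsPath-head π | _ , refl ← IsPath-head ρ = dominatesSeq⇒≼

  shadow : UnitSteps g → UnitSteps h → IsPath s t q →
           All (λ e → merge r c (Product.map g h e) ≤ᶻ merge r c e) q →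
           ∃[ q' ] (IsPath (Product.map g h s) (Product.map g h t) q' × M[ q' ] ≼ M[ q ])
  shadow g-steps h-steps single (below ∷ []) = _ , single , end below
  shadow {g = g} {h = h} {t = t} g-steps h-steps (cons st ρ) (below ∷ belows)
    with q' , ρ' , q'≼q ← shadow g-steps h-steps ρ belows | Step-image g-steps h-steps st
  ... | inj₁ st'   = _ , cons st' ρ' , advance below q'≼q
  ... | inj₂ fs≡fs' = q' , subst (λ v → IsPath v (Product.map g h t) q') (sym fs≡fs') ρ' ,
                      ≼-stay ρ' (subst (λ v → merge r c v ≤ᶻ merge r c _) fs≡fs' below) q'≼q

  best-≼ : UnitSteps g → UnitSteps h → Product.map g h s ≡ s' → Product.map g h t ≡ t' →
           IsPath s t q → All (λ e → merge r c (Product.map g h e) ≤ᶻ merge r c e) q →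
           IsPath s' t' p → (∀ q' → IsPath s' t' q' → Dominates r c p q') → M[ p ] ≼ M[ q ]
  best-≼ g-steps h-steps refl refl ρ belows π π-best
    with q' , ρ' , q'≼q ← shadow g-steps h-steps ρ belows =
    ≼-trans (dominates⇒≼ π ρ' (π-best q' ρ')) q'≼q

  ∘ₚ-≼ : IsPath s t p → IsPath t u p' → M[ p ] ≼ b → M[ p' ] ≼ b → M[ p ∘ₚ p' ] ≼ b
  ∘ₚ-≼ {p = p} π π' α β with p'' , refl ← IsPath-head π' =
    subst (_≼ _) (sym (map-++ (merge r c) p p'')) (≼-glue (IsPath-last (merge r c) π) α β)

  merge-choice-≤ : ∀ {i j x y x' y'} → x' ≡ x ⊎ x' ≡ i → y' ≡ y ⊎ y' ≡ j →
                   r i ≤ᶻ r x → c j ≤ᶻ c y → merge r c (x' , y') ≤ᶻ merge r c (x , y)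
  merge-choice-≤ x'-choice y'-choice ri≤rx cj≤cy =
    ℤ.+-mono-≤ (choice-≤ r x'-choice ri≤rx) (choice-≤ c y'-choice cj≤cy)
    where
    choice-≤ : ∀ (f : ℕ → ℤ) {k k' i} → k' ≡ k ⊎ k' ≡ i → f i ≤ᶻ f k → f k' ≤ᶻ f k
    choice-≤ f (inj₁ refl) _    = ℤ.≤-refl
    choice-≤ f (inj₂ refl) fi≤fk = fi≤fk

lemma3p7 : (m n : ℕ) (r c : ℕ → ℤ) (i j : ℕ) →
    1 ≤ i → i ≤ m → 1 ≤ j → j ≤ n →
    (∀ k → 1 ≤ k → k ≤ m → r i Data.Integer.≤ r k) →
    (∀ k → 1 ≤ k → k ≤ n → c j Data.Integer.≤ c k) →
    (p₁ p₂ : List (ℕ × ℕ)) →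
    IsPath (1 , 1) (i , j) p₁ →
    (∀ q → IsPath (1 , 1) (i , j) q → Dominates r c p₁ q) →
    IsPath (i , j) (m , n) p₂ →
    (∀ q → IsPath (i , j) (m , n) q → Dominates r c p₂ q) →
    IsPath (1 , 1) (m , n) (p₁ ∘ₚ p₂) ×
    (∀ q → IsPath (1 , 1) (m , n) q → Dominates r c (p₁ ∘ₚ p₂) q)
lemma3p7 m n r c i j 1≤i i≤m 1≤j j≤n r-min c-min p₁ p₂ π₁ π₁-best π₂ π₂-best =
  IsPath-∘ₚ π₁ π₂ , λ q ρ → ≼⇒dominatesSeq (∘ₚ-≼ r c π₁ π₂ (p₁-≼ ρ) (p₂-≼ ρ))
  where
  shadow-≤ : (_∙_ : ℕ → ℕ → ℕ) → Selective _∙_ → IsPath (1 , 1) (m , n) q →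
             All (λ e → merge r c (Product.map (_∙ i) (_∙ j) e) ≤ᶻ merge r c e) q
  shadow-≤ _∙_ ∙-sel ρ = All.map entry-≤ (IsPath⇒within ρ)
    where
    entry-≤ : ∀ {e} → (1 , 1) ≤² e × e ≤² (m , n) →
              merge r c (Product.map (_∙ i) (_∙ j) e) ≤ᶻ merge r c e
    entry-≤ {x , y} ((1≤x , 1≤y) , (x≤m , y≤n)) =
      merge-choice-≤ r c (∙-sel x i) (∙-sel y j) (r-min x 1≤x x≤m) (c-min y 1≤y y≤n)

  p₁-≼ : IsPath (1 , 1) (m , n) q → entries r c p₁ ≼ entries r c q
  p₁-≼ ρ = best-≼ r c (⊓-unitSteps i) (⊓-unitSteps j)
             (cong₂ _,_ (m≤n⇒m⊓n≡m 1≤i) (m≤n⇒m⊓n≡m 1≤j)) (cong₂ _,_ (m≥n⇒m⊓n≡n i≤m) (m≥n⇒m⊓n≡n j≤n))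
             ρ (shadow-≤ _⊓_ ⊓-sel ρ) π₁ π₁-best

  p₂-≼ : IsPath (1 , 1) (m , n) q → entries r c p₂ ≼ entries r c q
  p₂-≼ ρ = best-≼ r c (⊔-unitSteps i) (⊔-unitSteps j)
             (cong₂ _,_ (m≤n⇒m⊔n≡n 1≤i) (m≤n⇒m⊔n≡n 1≤j)) (cong₂ _,_ (m≥n⇒m⊔n≡m i≤m) (m≥n⇒m⊔n≡m j≤n))
             ρ (shadow-≤ _⊔_ ⊔-sel ρ) π₂ π₂-best
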